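{- Let $q\ge0$, $t\ge1$ be integers and $k_1\mid k_2$ positive integers. The map sending a critical configuration $w=[c_1,\dots,c_{k_1}]$ of $W_{k_1}(q,t)$ to the configuration $ww\cdots w$ of $W_{k_2}(q,t)$ (concatenation of $k_2/k_1$ copies of $w$) is an injective group homomorphism $K(W_{k_1}(q,t))\to K(W_{k_2}(q,t))$.
   Context: $W_k(q,t)$ is the directed multigraph with hub $v_0$ and rim vertices $v_1,\dots,v_k$ in clockwise order (indices mod $k$), with $t$ edges each way between $v_0$ and each $v_i$, one edge $v_i\to v_{i-1}$ and $q$ edges $v_i\to v_{i+1}$. Dollar game: a configuration is a vector $[c_1,\dots,c_k]$ of nonnegative integers; the bank $v_0$ holds $c_0=-(c_1+\dots+c_k)$. A rim vertex $v_i$ may fire if $c_i\ge1+q+t$; firing decreases $c_i$ by $1+q+t$, increases $c_{i+1}$ by $q$, $c_{i-1}$ by $1$ (indices mod $k$) and $c_0$ by $t$. The bank may fire only when no rim vertex can fire; firing adds $t$ to every $c_i$. Stable: no rim vertex can fire; recurrent: some nonempty legal firing sequence returns to it; critical: stable and recurrent. Every configuration reduces by legal firings to a unique critical configuration $\overline{C}$, and the critical configurations form an abelian group $K(W_k(q,t))$ under $C_1\oplus C_2=\overline{C_1+C_2}$ (pointwise sum). -}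

module Defs where

open import Data.Nat using (ℕ; zero; suc; _+_; _*_; _∸_; _<_; _≤_; NonZero; _≟_)
open import Data.Nat.DivMod using (_%_; m%n<n)
open import Data.Fin using (Fin; toℕ; fromℕ<)
open import Data.Product using (Σ; _×_; _,_)
open import Relation.Nullary using (Dec; yes; no)
open import Relation.Binary.PropositionalEquality using (_≡_)

ind : {P : Set} → Dec P → ℕ
ind (yes _) = 1
ind (no _)  = 0

-- A configuration of W_k(q,t): the chips c_1..c_k on the rim vertices,
-- rim vertex v_{i+1} is represented by i : Fin k.  The bank value
-- c_0 = -(c_1+...+c_k) is determined by the rim values and not stored.
Config : ℕ → Set
Config k = Fin k → ℕ

_≈c_ : {k : ℕ} → Config k → Config k → Set
c ≈c d = ∀ j → c j ≡ d j

_⊞_ : {k : ℕ} → Config k → Config k → Config k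
(c ⊞ d) j = c j + d j

module Wheel (q t k : ℕ) .{{_ : NonZero k}} where

  deg : ℕ
  deg = 1 + q + t

  -- rim vertex i fires: c_i loses 1+q+t, c_{i+1} gains q, c_{i-1} gains 1
  -- (indices mod k); the bank gains t (implicit).
  fire : Fin k → Config k → Config k
  fire i c j =
    (c j + q * ind (toℕ j ≟ (suc (toℕ i)) % k) + ind (toℕ i ≟ (suc (toℕ j)) % k))
      ∸ deg * ind (toℕ j ≟ toℕ i)

  bankFire : Config k → Config k
  bankFire c j = c j + t

  Stable : Config k → Set
  Stable c = ∀ i → c i < deg

  data Step (c : Config k) (d : Config k) : Set where
    rim  : (i : Fin k) → deg ≤ c i → d ≈c fire i c → Step c d
    bank : Stable c → d ≈c bankFire c → Step c d

  data Reach (c : Config k) (d : Config k) : Set where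
    done : c ≈c d → Reach c d
    step : {e : Config k} → Step c e → Reach e d → Reach c d

  Recurrent : Config k → Set
  Recurrent c = Σ (Config k) λ e → Step c e × Reach e c

  Critical : Config k → Set
  Critical c = Stable c × Recurrent c

  -- D = C₁ ⊕ C₂ (the unique critical configuration C₁ + C₂ reduces to)
  IsSum : Config k → Config k → Config k → Set
  IsSum C₁ C₂ D = Critical D × Reach (C₁ ⊞ C₂) D

repeatConfig : (k₁ k₂ : ℕ) .{{_ : NonZero k₁}} → Config k₁ → Config k₂
repeatConfig k₁ k₂ w j = w (fromℕ< (m%n<n (toℕ j) k₁))

-- Write m = k₂ / k₁ and call v_{i + r k₁} (r < m) the copies of v_i.  Firing v_i on W_{k₁}
-- is simulated on W_{k₂} by firing its m copies one after another: a copy only gains chips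
-- while the others fire, so every firing is legal, and since the neighbours of a copy are
-- copies of the neighbours of v_i, every vertex ends up with exactly the value of its
-- counterpart after the single firing.  Bank firings and stability correspond vertexwise,
-- so legal firing sequences lift, and with them recurrence and the reduction of C₁ + C₂
-- to C₁ ⊕ C₂.  Injectivity is read off the first k₁ vertices.
module Submission where

open import Defs
open import Data.Nat using (ℕ; zero; suc; _+_; _*_; _∸_; _<_; _≤_; _≥_; NonZero; _≟_; z<s; >-nonZero⁻¹)
open import Data.Nat.Properties
open import Data.Nat.DivMod
open import Data.Nat.Divisibility using (_∣_; divides; ∣-refl; n∣m*n; ∣⇒≤)
open import Data.Fin using (Fin; toℕ; fromℕ<; inject≤)
open import Data.Fin.Properties using (toℕ-injective; toℕ-fromℕ<; toℕ-inject≤; toℕ<n)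
open import Data.Product using (Σ; _×_; _,_)
open import Data.List using (_∷_; [])
open import Data.Empty using (⊥-elim)
open import Function.Bundles using (_⇔_; mk⇔; Equivalence)
open import Relation.Nullary using (Dec; yes; no; ¬_)
open import Relation.Binary.PropositionalEquality
open import Data.Nat.Tactic.RingSolver using (solve)

ind-cong : {P Q : Set} (p? : Dec P) (q? : Dec Q) → P ⇔ Q → ind p? ≡ ind q?
ind-cong (yes _) (yes _) _   = refl
ind-cong (yes p) (no ¬q) P⇔Q = ⊥-elim (¬q (Equivalence.to P⇔Q p))
ind-cong (no ¬p) (yes q) P⇔Q = ⊥-elim (¬p (Equivalence.from P⇔Q q))
ind-cong (no _)  (no _)  _   = refl

ind-yes : {P : Set} (p? : Dec P) → P → ind p? ≡ 1
ind-yes (yes _) _ = refl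
ind-yes (no ¬p) p = ⊥-elim (¬p p)

ind-no : {P : Set} (p? : Dec P) → ¬ P → ind p? ≡ 0
ind-no (yes p) ¬p = ⊥-elim (¬p p)
ind-no (no _)  _  = refl

sumBelow : ℕ → (ℕ → ℕ) → ℕ
sumBelow zero    f = 0
sumBelow (suc n) f = sumBelow n f + f n

sumBelow-cong : ∀ n {f g : ℕ → ℕ} → (∀ r → r < n → f r ≡ g r) → sumBelow n f ≡ sumBelow n g
sumBelow-cong zero    f≗g = refl
sumBelow-cong (suc n) f≗g =
  cong₂ _+_ (sumBelow-cong n (λ r r<n → f≗g r (m<n⇒m<1+n r<n))) (f≗g n ≤-refl)

sumBelow-zero : ∀ n {f : ℕ → ℕ} → (∀ r → r < n → f r ≡ 0) → sumBelow n f ≡ 0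
sumBelow-zero zero    f≗0 = refl
sumBelow-zero (suc n) f≗0 =
  cong₂ _+_ (sumBelow-zero n (λ r r<n → f≗0 r (m<n⇒m<1+n r<n))) (f≗0 n ≤-refl)

sumBelow-single : ∀ n {f : ℕ → ℕ} {r₀} → r₀ < n → f r₀ ≡ 1 →
  (∀ r → r < n → r ≢ r₀ → f r ≡ 0) → sumBelow n f ≡ 1
sumBelow-single (suc n) {r₀ = r₀} r₀<1+n fr₀≡1 f≗0 with n ≟ r₀
... | yes refl = cong₂ _+_ (sumBelow-zero n (λ r r<n → f≗0 r (m<n⇒m<1+n r<n) (<⇒≢ r<n))) fr₀≡1
... | no n≢r₀  = cong₂ _+_
  (sumBelow-single n (≤∧≢⇒< (≤-pred r₀<1+n) (≢-sym n≢r₀)) fr₀≡1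
    (λ r r<n → f≗0 r (m<n⇒m<1+n r<n)))
  (f≗0 n ≤-refl n≢r₀)

module _ {d : ℕ} .{{_ : NonZero d}} where

  [m%d+n]%d≡[m+n]%d : ∀ m n → (m % d + n) % d ≡ (m + n) % d
  [m%d+n]%d≡[m+n]%d m n = begin
    (m % d + n) % d            ≡⟨ %-distribˡ-+ (m % d) n d ⟩
    (m % d % d + n % d) % d    ≡⟨ cong (λ x → (x + n % d) % d) (m%n%n≡m%n m d) ⟩
    (m % d + n % d) % d        ≡⟨ %-distribˡ-+ m n d ⟨
    (m + n) % d                ∎
    where open ≡-Reasoning

  %-suc : ∀ a → suc a % d ≡ suc (a % d) % d
  %-suc a = begin
    suc a % d        ≡⟨ cong (_% d) (+-comm 1 a) ⟩
    (a + 1) % d      ≡⟨ [m%d+n]%d≡[m+n]%d a 1 ⟨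
    (a % d + 1) % d  ≡⟨ cong (_% d) (+-comm (a % d) 1) ⟩
    suc (a % d) % d  ∎
    where open ≡-Reasoning

  %-suc-cong : ∀ {a b} → a % d ≡ b % d → suc a % d ≡ suc b % d
  %-suc-cong {a} {b} a≡b = trans (%-suc a) (trans (cong (λ x → suc x % d) a≡b) (sym (%-suc b)))

  [1+[x+n∸1]]%d≡x%d : ∀ x n .{{_ : NonZero n}} → d ∣ n → suc (x + (n ∸ 1)) % d ≡ x % d
  [1+[x+n∸1]]%d≡x%d x n@(suc _) d∣n = trans (cong (_% d) (sym (+-suc x (n ∸ 1)))) (%-remove-+ʳ x d∣n)

  %-suc-injective : ∀ {a b} → suc a % d ≡ suc b % d → a % d ≡ b % d
  %-suc-injective {a} {b} sa≡sb = begin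
    a % d                            ≡⟨ [1+[x+n∸1]]%d≡x%d a d ∣-refl ⟨
    (suc a + (d ∸ 1)) % d            ≡⟨ [m%d+n]%d≡[m+n]%d (suc a) (d ∸ 1) ⟨
    (suc a % d + (d ∸ 1)) % d        ≡⟨ cong (λ x → (x + (d ∸ 1)) % d) sa≡sb ⟩
    (suc b % d + (d ∸ 1)) % d        ≡⟨ [m%d+n]%d≡[m+n]%d (suc b) (d ∸ 1) ⟩
    (suc b + (d ∸ 1)) % d            ≡⟨ [1+[x+n∸1]]%d≡x%d b d ∣-refl ⟩
    b % d                            ∎
    where open ≡-Reasoning

  x%d≡[1+a]%d⇔[x+n∸1]%d≡a%d : ∀ x a n .{{_ : NonZero n}} → d ∣ n →
    (x % d ≡ suc a % d) ⇔ ((x + (n ∸ 1)) % d ≡ a % d)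
  x%d≡[1+a]%d⇔[x+n∸1]%d≡a%d x a n d∣n = mk⇔
    (λ x≡1+a → %-suc-injective (trans shift x≡1+a))
    (λ z≡a → trans (sym shift) (%-suc-cong z≡a))
    where
    shift : suc (x + (n ∸ 1)) % d ≡ x % d
    shift = [1+[x+n∸1]]%d≡x%d x n d∣n

module Copies (k m i : ℕ) .{{_ : NonZero k}} (i<k : i < k) where

  copy : ℕ → ℕ
  copy r = i + r * k

  copy-injective : ∀ r s → copy r ≡ copy s → r ≡ s
  copy-injective r s eq = *-cancelʳ-≡ r s k (+-cancelˡ-≡ i _ _ eq)

  copy%k≡i : ∀ r → copy r % k ≡ i
  copy%k≡i r = trans ([m+kn]%n≡m%n i r k) (m<n⇒m%n≡m i<k)

  copy<m*k : ∀ {r} → r < m → copy r < m * k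
  copy<m*k {r} r<m = ≤-trans (+-monoˡ-< (r * k) i<k) (*-monoˡ-≤ k r<m)

  -- the copy containing x is the one with index x / k
  count-copies : ∀ {x} → x < m * k → sumBelow m (λ r → ind (x ≟ copy r)) ≡ ind (x % k ≟ i)
  count-copies {x} x<m*k with x % k ≟ i
  ... | yes x%k≡i = sumBelow-single m (m<n*o⇒m/o<n x<m*k) (ind-yes _ x≡copy[x/k])
        (λ r _ r≢x/k → ind-no _ (λ x≡copy[r] →
          r≢x/k (copy-injective r _ (trans (sym x≡copy[r]) x≡copy[x/k]))))
    where
    x≡copy[x/k] : x ≡ copy (x / k)
    x≡copy[x/k] = trans (m≡m%n+[m/n]*n x k) (cong (_+ (x / k) * k) x%k≡i)
  ... | no x%k≢i = sumBelow-zero m (λ r _ → ind-no _ (λ x≡copy[r] →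
        x%k≢i (trans (cong (_% k) x≡copy[r]) (copy%k≡i r))))

module WheelProperties (q t k : ℕ) .{{_ : NonZero k}} where
  open Wheel q t k

  fire-cong : ∀ i {c d : Config k} → c ≈c d → fire i c ≈c fire i d
  fire-cong i c≈d j = cong (λ x → (x + q * ind (toℕ j ≟ suc (toℕ i) % k) + ind (toℕ i ≟ suc (toℕ j) % k))
    ∸ deg * ind (toℕ j ≟ toℕ i)) (c≈d j)

  -- legality makes the truncated subtraction in fire exact
  fire-balance : ∀ i j (c : Config k) → (j ≡ i → deg ≤ c i) →
    fire i c j + deg * ind (toℕ j ≟ toℕ i)
      ≡ c j + q * ind (toℕ j ≟ suc (toℕ i) % k) + ind (toℕ i ≟ suc (toℕ j) % k)
  fire-balance i j c ready = m∸n*ind+n*ind≡m (toℕ j ≟ toℕ i) λ j≡i → begin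
    deg                                                          ≤⟨ ready (toℕ-injective j≡i) ⟩
    c i                                                          ≡⟨ cong c (toℕ-injective j≡i) ⟨
    c j                                                          ≤⟨ m≤m+n (c j) _ ⟩
    c j + q * ind (toℕ j ≟ suc (toℕ i) % k)                      ≤⟨ m≤m+n _ _ ⟩
    c j + q * ind (toℕ j ≟ suc (toℕ i) % k) + ind (toℕ i ≟ suc (toℕ j) % k) ∎
    where
    open ≤-Reasoning
    m∸n*ind+n*ind≡m : ∀ {P : Set} {m n} (p? : Dec P) → (P → n ≤ m) → m ∸ n * ind p? + n * ind p? ≡ m
    m∸n*ind+n*ind≡m {m = m} {n} (yes p) n≤m = m∸n+n≡m (subst (_≤ m) (sym (*-identityʳ n)) (n≤m p))
    m∸n*ind+n*ind≡m {m = m} {n} (no _)  _   rewrite *-zeroʳ n = +-identityʳ m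

  fire-mono : ∀ i j (c : Config k) → j ≢ i → c j ≤ fire i c j
  fire-mono i j c j≢i = m≤m+a+b∸n*ind {n = deg} (toℕ j ≟ toℕ i) (λ j≡i → j≢i (toℕ-injective j≡i))
    where
    m≤m+a+b∸n*ind : ∀ {P : Set} {m a b n} (p? : Dec P) → ¬ P → m ≤ m + a + b ∸ n * ind p?
    m≤m+a+b∸n*ind (yes p) ¬p = ⊥-elim (¬p p)
    m≤m+a+b∸n*ind {m = m} {a} {b} {n} (no _) _ rewrite *-zeroʳ n = ≤-trans (m≤m+n m a) (m≤m+n (m + a) b)

  Step-congˡ : ∀ {c c′ d} → c ≈c c′ → Step c′ d → Step c d
  Step-congˡ c≈c′ (rim i ready d≈) =
    rim i (subst (deg ≤_) (sym (c≈c′ i)) ready)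
      (λ j → trans (d≈ j) (fire-cong i (λ j′ → sym (c≈c′ j′)) j))
  Step-congˡ c≈c′ (bank stable d≈) =
    bank (λ i → subst (_< deg) (sym (c≈c′ i)) (stable i))
      (λ j → trans (d≈ j) (cong (_+ t) (sym (c≈c′ j))))

  Reach-congˡ : ∀ {c c′ d} → c ≈c c′ → Reach c′ d → Reach c d
  Reach-congˡ c≈c′ (done c′≈d) = done (λ j → trans (c≈c′ j) (c′≈d j))
  Reach-congˡ c≈c′ (step s r)  = step (Step-congˡ c≈c′ s) r

  Reach-congʳ : ∀ {c d d′} → Reach c d → d ≈c d′ → Reach c d′
  Reach-congʳ (done c≈d) d≈d′ = done (λ j → trans (c≈d j) (d≈d′ j))
  Reach-congʳ (step s r) d≈d′ = step s (Reach-congʳ r d≈d′)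

  Reach-trans : ∀ {c d e} → Reach c d → Reach d e → Reach c e
  Reach-trans (done c≈d) r′ = Reach-congˡ c≈d r′
  Reach-trans (step s r) r′ = step s (Reach-trans r r′)

  Reach⁺ : Config k → Config k → Set
  Reach⁺ c d = Σ (Config k) λ e → Step c e × Reach e d

  Reach⁺⇒Reach : ∀ {c d} → Reach⁺ c d → Reach c d
  Reach⁺⇒Reach (_ , s , r) = step s r

  Reach⁺-trans : ∀ {c d e} → Reach⁺ c d → Reach d e → Reach⁺ c e
  Reach⁺-trans (e , s , r) r′ = e , s , Reach-trans r r′

  Reach⁺-congʳ : ∀ {c d d′} → Reach⁺ c d → d ≈c d′ → Reach⁺ c d′
  Reach⁺-congʳ (e , s , r) d≈d′ = e , s , Reach-congʳ r d≈d′

  Reach-snoc : ∀ {c d e} → Reach c d → Step d e → Reach⁺ c e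
  Reach-snoc {e = e} (done c≈d) s = e , Step-congˡ c≈d s , done (λ _ → refl)
  Reach-snoc (step {e′} s′ r) s   = e′ , s′ , Reach⁺⇒Reach (Reach-snoc r s)

  module FireSequence (p : ℕ → Fin k) (n : ℕ) (c : Config k)
         (p-distinct : ∀ {r s} → r < s → s < n → p r ≢ p s)
         (p-ready : ∀ r → r < n → deg ≤ c (p r)) where

    after : ℕ → Config k
    after zero    = c
    after (suc r) = fire (p r) (after r)

    after-mono : ∀ r j → (∀ s → s < r → j ≢ p s) → c j ≤ after r j
    after-mono zero    j _        = ≤-refl
    after-mono (suc r) j unfired = ≤-trans (after-mono r j (λ s s<r → unfired s (m<n⇒m<1+n s<r)))
      (fire-mono (p r) j (after r) (unfired r ≤-refl))

    after-ready : ∀ r → r < n → deg ≤ after r (p r)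
    after-ready r r<n = ≤-trans (p-ready r r<n)
      (after-mono r (p r) (λ s s<r pr≡ps → p-distinct s<r r<n (sym pr≡ps)))

    after-reach : ∀ r → r ≤ n → Reach c (after r)
    after-reach⁺ : ∀ r → 0 < r → r ≤ n → Reach⁺ c (after r)

    after-reach zero    _   = done (λ _ → refl)
    after-reach (suc r) r<n = Reach⁺⇒Reach (after-reach⁺ (suc r) z<s r<n)

    after-reach⁺ (suc r) _ r<n =
      Reach-snoc (after-reach r (<⇒≤ r<n)) (rim (p r) (after-ready r r<n) (λ _ → refl))

    after-balance : ∀ r → r ≤ n → ∀ j →
      after r j + deg * sumBelow r (λ s → ind (toℕ j ≟ toℕ (p s)))
        ≡ c j + q * sumBelow r (λ s → ind (toℕ j ≟ suc (toℕ (p s)) % k))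
              + sumBelow r (λ s → ind (toℕ (p s) ≟ suc (toℕ j) % k))
    after-balance zero _ j = begin
      c j + deg * 0    ≡⟨ cong (c j +_) (*-zeroʳ deg) ⟩
      c j + 0          ≡⟨ cong (c j +_) (*-zeroʳ q) ⟨
      c j + q * 0      ≡⟨ +-identityʳ _ ⟨
      c j + q * 0 + 0  ∎
      where open ≡-Reasoning
    after-balance (suc r) r<n j =
      accumulate deg q (after (suc r) j) (after r j) (c j)
        (firedHere r) (firedPred r) (firedSucc r)
        (sumBelow r firedHere) (sumBelow r firedPred) (sumBelow r firedSucc)
        (fire-balance (p r) j (after r) (λ _ → after-ready r r<n))
        (after-balance r (<⇒≤ r<n) j)
      where
      open ≡-Reasoning
      firedHere firedPred firedSucc : ℕ → ℕ
      firedHere s = ind (toℕ j ≟ toℕ (p s))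
      firedPred s = ind (toℕ j ≟ suc (toℕ (p s)) % k)
      firedSucc s = ind (toℕ (p s) ≟ suc (toℕ j) % k)

      accumulate : ∀ D Q y x w a b e A B E → y + D * a ≡ x + Q * b + e → x + D * A ≡ w + Q * B + E →
        y + D * (A + a) ≡ w + Q * (B + b) + (E + e)
      accumulate D Q y x w a b e A B E fired before = begin
        y + D * (A + a)            ≡⟨ solve (y ∷ D ∷ A ∷ a ∷ []) ⟩
        (y + D * a) + D * A        ≡⟨ cong (_+ D * A) fired ⟩
        x + Q * b + e + D * A      ≡⟨ solve (x ∷ Q ∷ b ∷ e ∷ D ∷ A ∷ []) ⟩
        (x + D * A) + Q * b + e    ≡⟨ cong (λ z → z + Q * b + e) before ⟩
        w + Q * B + E + Q * b + e  ≡⟨ solve (w ∷ Q ∷ B ∷ E ∷ b ∷ e ∷ []) ⟩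
        w + Q * (B + b) + (E + e)  ∎

module Lift (q t k₁ m : ℕ) .{{_ : NonZero k₁}} .{{_ : NonZero (m * k₁)}} where
  module W₁ = Wheel q t k₁
  module W₂ = Wheel q t (m * k₁)
  module P₁ = WheelProperties q t k₁
  module P₂ = WheelProperties q t (m * k₁)

  rep : Config k₁ → Config (m * k₁)
  rep = repeatConfig k₁ (m * k₁)

  idx : Fin (m * k₁) → Fin k₁
  idx j = fromℕ< (m%n<n (toℕ j) k₁)

  toℕ-idx : ∀ j → toℕ (idx j) ≡ toℕ j % k₁
  toℕ-idx j = toℕ-fromℕ< (m%n<n (toℕ j) k₁)

  rep-stable : ∀ {c} → W₁.Stable c → W₂.Stable (rep c)
  rep-stable stable j = stable (idx j)

  module _ (i : Fin k₁) where
    open Copies k₁ m (toℕ i) (toℕ<n i)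

    copyFin : ℕ → Fin (m * k₁)
    copyFin r = fromℕ< (m%n<n (copy r) (m * k₁))

    toℕ-copyFin : ∀ {r} → r < m → toℕ (copyFin r) ≡ copy r
    toℕ-copyFin r<m = trans (toℕ-fromℕ< _) (m<n⇒m%n≡m (copy<m*k r<m))

    idx-copyFin : ∀ {r} → r < m → idx (copyFin r) ≡ i
    idx-copyFin {r} r<m = toℕ-injective (trans (toℕ-idx _) (trans (cong (_% k₁) (toℕ-copyFin r<m)) (copy%k≡i r)))

    count-copies-mod : ∀ y → sumBelow m (λ r → ind (y % (m * k₁) ≟ copy r)) ≡ ind (y % k₁ ≟ toℕ i)
    count-copies-mod y = trans (count-copies (m%n<n y (m * k₁)))
      (cong (λ z → ind (z ≟ toℕ i)) (m∣n⇒o%n%m≡o%m k₁ (m * k₁) y (n∣m*n m)))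

    module _ (j : Fin (m * k₁)) where
      private
        x = toℕ j
        x%k₂≡x : x % (m * k₁) ≡ x
        x%k₂≡x = m<n⇒m%n≡m (toℕ<n j)

      count-here : sumBelow m (λ r → ind (x ≟ toℕ (copyFin r))) ≡ ind (toℕ (idx j) ≟ toℕ i)
      count-here = begin
        sumBelow m (λ r → ind (x ≟ toℕ (copyFin r)))
          ≡⟨ sumBelow-cong m (λ r r<m → cong₂ (λ u v → ind (u ≟ v)) (sym x%k₂≡x) (toℕ-copyFin r<m)) ⟩
        sumBelow m (λ r → ind (x % (m * k₁) ≟ copy r))
          ≡⟨ count-copies-mod x ⟩
        ind (x % k₁ ≟ toℕ i)
          ≡⟨ cong (λ u → ind (u ≟ toℕ i)) (toℕ-idx j) ⟨
        ind (toℕ (idx j) ≟ toℕ i) ∎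
        where open ≡-Reasoning

      count-pred : sumBelow m (λ r → ind (x ≟ suc (toℕ (copyFin r)) % (m * k₁)))
                   ≡ ind (toℕ (idx j) ≟ suc (toℕ i) % k₁)
      count-pred = begin
        sumBelow m (λ r → ind (x ≟ suc (toℕ (copyFin r)) % (m * k₁)))
          ≡⟨ sumBelow-cong m (λ r r<m → begin
               ind (x ≟ suc (toℕ (copyFin r)) % (m * k₁))
                 ≡⟨ cong₂ (λ u v → ind (u ≟ suc v % (m * k₁))) (sym x%k₂≡x) (toℕ-copyFin r<m) ⟩
               ind (x % (m * k₁) ≟ suc (copy r) % (m * k₁))
                 ≡⟨ ind-cong _ _ (x%d≡[1+a]%d⇔[x+n∸1]%d≡a%d x (copy r) (m * k₁) ∣-refl) ⟩
               ind (y % (m * k₁) ≟ copy r % (m * k₁))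
                 ≡⟨ cong (λ v → ind (y % (m * k₁) ≟ v)) (m<n⇒m%n≡m (copy<m*k r<m)) ⟩
               ind (y % (m * k₁) ≟ copy r) ∎) ⟩
        sumBelow m (λ r → ind (y % (m * k₁) ≟ copy r))
          ≡⟨ count-copies-mod y ⟩
        ind (y % k₁ ≟ toℕ i)
          ≡⟨ cong (λ v → ind (y % k₁ ≟ v)) (m<n⇒m%n≡m (toℕ<n i)) ⟨
        ind (y % k₁ ≟ toℕ i % k₁)
          ≡⟨ ind-cong _ _ (x%d≡[1+a]%d⇔[x+n∸1]%d≡a%d x (toℕ i) (m * k₁) (n∣m*n m)) ⟨
        ind (x % k₁ ≟ suc (toℕ i) % k₁)
          ≡⟨ cong (λ u → ind (u ≟ suc (toℕ i) % k₁)) (toℕ-idx j) ⟨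
        ind (toℕ (idx j) ≟ suc (toℕ i) % k₁) ∎
        where
        open ≡-Reasoning
        y = x + (m * k₁ ∸ 1)

      count-succ : sumBelow m (λ r → ind (toℕ (copyFin r) ≟ suc x % (m * k₁)))
                   ≡ ind (toℕ i ≟ suc (toℕ (idx j)) % k₁)
      count-succ = begin
        sumBelow m (λ r → ind (toℕ (copyFin r) ≟ suc x % (m * k₁)))
          ≡⟨ sumBelow-cong m (λ r r<m → trans (ind-cong _ _ (mk⇔ sym sym))
               (cong (λ v → ind (suc x % (m * k₁) ≟ v)) (toℕ-copyFin r<m))) ⟩
        sumBelow m (λ r → ind (suc x % (m * k₁) ≟ copy r))
          ≡⟨ count-copies-mod (suc x) ⟩
        ind (suc x % k₁ ≟ toℕ i)
          ≡⟨ ind-cong _ _ (mk⇔ sym sym) ⟩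
        ind (toℕ i ≟ suc x % k₁)
          ≡⟨ cong (λ v → ind (toℕ i ≟ v)) (trans (%-suc x) (cong (λ u → suc u % k₁) (sym (toℕ-idx j)))) ⟩
        ind (toℕ i ≟ suc (toℕ (idx j)) % k₁) ∎
        where open ≡-Reasoning

    lift-fire : ∀ c → W₁.deg ≤ c i → P₂.Reach⁺ (rep c) (rep (W₁.fire i c))
    lift-fire c ready =
      P₂.Reach⁺-congʳ (after-reach⁺ m (>-nonZero⁻¹ m {{m*n≢0⇒m≢0 m}}) ≤-refl) after≈rep-fire
      where
      copies-distinct : ∀ {r s} → r < s → s < m → copyFin r ≢ copyFin s
      copies-distinct {r} {s} r<s s<m eq = <⇒≢ r<s (copy-injective r s (begin
        copy r            ≡⟨ toℕ-copyFin (<-trans r<s s<m) ⟨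
        toℕ (copyFin r)   ≡⟨ cong toℕ eq ⟩
        toℕ (copyFin s)   ≡⟨ toℕ-copyFin s<m ⟩
        copy s            ∎))
        where open ≡-Reasoning

      copies-ready : ∀ r → r < m → W₂.deg ≤ rep c (copyFin r)
      copies-ready r r<m = subst (λ v → W₁.deg ≤ c v) (sym (idx-copyFin r<m)) ready

      open P₂.FireSequence copyFin m (rep c) copies-distinct copies-ready

      after≈rep-fire : after m ≈c rep (W₁.fire i c)
      after≈rep-fire j = +-cancelʳ-≡ _ (after m j) (rep (W₁.fire i c) j) (begin
        after m j + W₁.deg * ind (toℕ (idx j) ≟ toℕ i)
          ≡⟨ cong (λ n → after m j + W₁.deg * n) (count-here j) ⟨
        after m j + W₂.deg * sumBelow m (λ r → ind (toℕ j ≟ toℕ (copyFin r)))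
          ≡⟨ after-balance m ≤-refl j ⟩
        rep c j + q * sumBelow m (λ r → ind (toℕ j ≟ suc (toℕ (copyFin r)) % (m * k₁)))
                + sumBelow m (λ r → ind (toℕ (copyFin r) ≟ suc (toℕ j) % (m * k₁)))
          ≡⟨ cong₂ (λ a b → c (idx j) + q * a + b) (count-pred j) (count-succ j) ⟩
        c (idx j) + q * ind (toℕ (idx j) ≟ suc (toℕ i) % k₁) + ind (toℕ i ≟ suc (toℕ (idx j)) % k₁)
          ≡⟨ P₁.fire-balance i (idx j) c (λ _ → ready) ⟨
        W₁.fire i c (idx j) + W₁.deg * ind (toℕ (idx j) ≟ toℕ i) ∎)
        where open ≡-Reasoning

  lift-step : ∀ {c d} → W₁.Step c d → P₂.Reach⁺ (rep c) (rep d)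
  lift-step {c} (W₁.rim i ready d≈) = P₂.Reach⁺-congʳ (lift-fire i c ready) (λ j → sym (d≈ (idx j)))
  lift-step {d = d} (W₁.bank stable d≈) =
    rep d , W₂.bank (rep-stable stable) (λ j → d≈ (idx j)) , W₂.done (λ _ → refl)

  lift-reach : ∀ {c d} → W₁.Reach c d → W₂.Reach (rep c) (rep d)
  lift-reach (W₁.done c≈d) = W₂.done (λ j → c≈d (idx j))
  lift-reach (W₁.step s r) = P₂.Reach-trans (P₂.Reach⁺⇒Reach (lift-step s)) (lift-reach r)

  lift-critical : ∀ w → W₁.Critical w → W₂.Critical (rep w)
  lift-critical w (stable , _ , s , r) = rep-stable stable , P₂.Reach⁺-trans (lift-step s) (lift-reach r)

  rep-injective : ∀ {w₁ w₂} → rep w₁ ≈c rep w₂ → w₁ ≈c w₂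
  rep-injective {w₁} {w₂} rep-w₁≈rep-w₂ i = subst (λ v → w₁ v ≡ w₂ v) idx-i′≡i (rep-w₁≈rep-w₂ i′)
    where
    i′ : Fin (m * k₁)
    i′ = inject≤ i (∣⇒≤ (n∣m*n m))

    idx-i′≡i : idx i′ ≡ i
    idx-i′≡i = toℕ-injective (trans (toℕ-idx i′)
      (trans (cong (_% k₁) (toℕ-inject≤ i _)) (m<n⇒m%n≡m (toℕ<n i))))

proposition5 : (q t : ℕ) → t ≥ 1 → (k₁ k₂ : ℕ) .{{_ : NonZero k₁}} .{{_ : NonZero k₂}} → k₁ ∣ k₂ →
    ((w : Config k₁) → Wheel.Critical q t k₁ w → Wheel.Critical q t k₂ (repeatConfig k₁ k₂ w))
    × ((w₁ w₂ D : Config k₁) → Wheel.Critical q t k₁ w₁ → Wheel.Critical q t k₁ w₂ →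
        Wheel.IsSum q t k₁ w₁ w₂ D →
        Wheel.IsSum q t k₂ (repeatConfig k₁ k₂ w₁) (repeatConfig k₁ k₂ w₂) (repeatConfig k₁ k₂ D))
    × ((w₁ w₂ : Config k₁) → Wheel.Critical q t k₁ w₁ → Wheel.Critical q t k₁ w₂ →
        repeatConfig k₁ k₂ w₁ ≈c repeatConfig k₁ k₂ w₂ → w₁ ≈c w₂)
proposition5 q t _ k₁ .(m * k₁) (divides m refl) =
  lift-critical ,
  (λ { _ _ D _ _ (D-critical , w₁⊞w₂⇝D) → lift-critical D D-critical , lift-reach w₁⊞w₂⇝D }) ,
  (λ _ _ _ _ → rep-injective)
  where open Lift q t k₁ m
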